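{- Let $\mathbf{A}_1,\mathbf{A}_2$ be Stonean residuated lattices and let $(h,k)$ be a morphism in $\mathfrak{T}$ from $(\mathbf{B}(\mathbf{A}_1),\mathbf{D}(\mathbf{A}_1),\phi_{\mathbf{A}_1})$ to $(\mathbf{B}(\mathbf{A}_2),\mathbf{D}(\mathbf{A}_2),\phi_{\mathbf{A}_2})$. Let $a\in B(\mathbf{A}_1)$ and $d,e\in D(\mathbf{A}_1)$. If $a\ast d=a\ast e$, then $h(a)\ast k(d)=h(a)\ast k(e)$.
   Context: A residuated lattice is an algebra $(A,\ast,\to,\vee,\wedge,\top)$ with $(A,\ast,\top)$ a commutative monoid, $(A,\vee,\wedge)$ a lattice with top $\top$, and $x\ast y\le z$ iff $x\le y\to z$. A bounded residuated lattice also has a least element $\bot$; $\neg x:=x\to\bot$. Dense elements: $\neg x=\bot$, forming a residuated lattice $\mathbf{D}(\mathbf{A})$. Boolean elements: $x\vee\neg x=\top$, $x\wedge\neg x=\bot$, forming a Boolean algebra $\mathbf{B}(\mathbf{A})$. Stonean: bounded residuated lattice satisfying $\neg x\vee\neg\neg x=\top$. i-filters of $\mathbf{D}$: subsets $F\ni\top$ with $x,x\to y\in F\Rightarrow y\in F$; $\mathcal{F}_i(\mathbf{D})$ their lattice under inclusion. $\phi_{\mathbf{A}}(a)=\{x\in D(\mathbf{A}):x\ge\neg a\}$ for $a\in B(\mathbf{A})$. A morphism in $\mathfrak{T}$ from $(\mathbf{B}_1,\mathbf{D}_1,\phi_1)$ to $(\mathbf{B}_2,\mathbf{D}_2,\phi_2)$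 is a pair $(h,k)$ with $h$ a Boolean algebra homomorphism $\mathbf{B}_1\to\mathbf{B}_2$, $k$ a residuated lattice homomorphism $\mathbf{D}_1\to\mathbf{D}_2$, and $k(\phi_1(a))\subseteq\phi_2(h(a))$ for all $a\in B_1$. -}

module Defs where

open import Level using (Level; suc; _⊔_)
open import Data.Product using (Σ; _×_; _,_; proj₁; proj₂)
open import Relation.Binary.PropositionalEquality using (_≡_)
open import Function.Bundles using (_⇔_)

record BRL (c : Level) : Set (suc c) where
  infixr 8 _∗_
  infixr 7 _⇒_
  infixr 5 _∨_
  infixr 6 _∧_
  field
    Carrier : Set c
    _∗_ _⇒_ _∨_ _∧_ : Carrier → Carrier → Carrier
    ⊤ ⊥ : Carrier
    ∗-assoc : ∀ x y z → (x ∗ y) ∗ z ≡ x ∗ (y ∗ z)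
    ∗-comm : ∀ x y → x ∗ y ≡ y ∗ x
    ∗-identityʳ : ∀ x → x ∗ ⊤ ≡ x
    ∨-assoc : ∀ x y z → (x ∨ y) ∨ z ≡ x ∨ (y ∨ z)
    ∨-comm : ∀ x y → x ∨ y ≡ y ∨ x
    ∧-assoc : ∀ x y z → (x ∧ y) ∧ z ≡ x ∧ (y ∧ z)
    ∧-comm : ∀ x y → x ∧ y ≡ y ∧ x
    ∨-absorbs-∧ : ∀ x y → x ∨ (x ∧ y) ≡ x
    ∧-absorbs-∨ : ∀ x y → x ∧ (x ∨ y) ≡ x
    ⊤-top : ∀ x → x ∧ ⊤ ≡ x
    ⊥-bot : ∀ x → ⊥ ∧ x ≡ ⊥

  infix 4 _≤_
  _≤_ : Carrier → Carrier → Set c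
  x ≤ y = x ∧ y ≡ x

  field
    residuated : ∀ x y z → (x ∗ y ≤ z) ⇔ (x ≤ (y ⇒ z))

  infix 9 ¬_
  ¬_ : Carrier → Carrier
  ¬ x = x ⇒ ⊥

  IsDense : Carrier → Set c
  IsDense x = ¬ x ≡ ⊥

  IsBoolean : Carrier → Set c
  IsBoolean x = (x ∨ ¬ x ≡ ⊤) × (x ∧ ¬ x ≡ ⊥)

  D : Set c
  D = Σ Carrier IsDense

  B : Set c
  B = Σ Carrier IsBoolean

  φ : B → D → Set c
  φ a x = ¬ (proj₁ a) ≤ proj₁ x

IsStonean : ∀ {c} → BRL c → Set c
IsStonean A = ∀ x → (¬ x) ∨ (¬ (¬ x)) ≡ ⊤
  where open BRL A

-- Since B(A) is a subset (Σ-type), the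
-- conditions are stated for all membership proofs of the arguments/results.
record IsBAHom {c₁ c₂} (A₁ : BRL c₁) (A₂ : BRL c₂)
               (h : BRL.B A₁ → BRL.B A₂) : Set (c₁ ⊔ c₂) where
  private
    module A₁ = BRL A₁
    module A₂ = BRL A₂
  field
    pres-∨ : ∀ x y → (p : A₁.IsBoolean x) (q : A₁.IsBoolean y)
             (r : A₁.IsBoolean (x A₁.∨ y)) →
             proj₁ (h (x A₁.∨ y , r)) ≡ proj₁ (h (x , p)) A₂.∨ proj₁ (h (y , q))
    pres-∧ : ∀ x y → (p : A₁.IsBoolean x) (q : A₁.IsBoolean y)
             (r : A₁.IsBoolean (x A₁.∧ y)) →
             proj₁ (h (x A₁.∧ y , r)) ≡ proj₁ (h (x , p)) A₂.∧ proj₁ (h (y , q))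
    pres-¬ : ∀ x → (p : A₁.IsBoolean x) (r : A₁.IsBoolean (A₁.¬ x)) →
             proj₁ (h (A₁.¬ x , r)) ≡ A₂.¬ proj₁ (h (x , p))
    pres-⊤ : (r : A₁.IsBoolean A₁.⊤) → proj₁ (h (A₁.⊤ , r)) ≡ A₂.⊤
    pres-⊥ : (r : A₁.IsBoolean A₁.⊥) → proj₁ (h (A₁.⊥ , r)) ≡ A₂.⊥

record IsRLHom {c₁ c₂} (A₁ : BRL c₁) (A₂ : BRL c₂)
               (k : BRL.D A₁ → BRL.D A₂) : Set (c₁ ⊔ c₂) where
  private
    module A₁ = BRL A₁
    module A₂ = BRL A₂
  field
    pres-∗ : ∀ x y → (p : A₁.IsDense x) (q : A₁.IsDense y)
             (r : A₁.IsDense (x A₁.∗ y)) →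
             proj₁ (k (x A₁.∗ y , r)) ≡ proj₁ (k (x , p)) A₂.∗ proj₁ (k (y , q))
    pres-⇒ : ∀ x y → (p : A₁.IsDense x) (q : A₁.IsDense y)
             (r : A₁.IsDense (x A₁.⇒ y)) →
             proj₁ (k (x A₁.⇒ y , r)) ≡ proj₁ (k (x , p)) A₂.⇒ proj₁ (k (y , q))
    pres-∨ : ∀ x y → (p : A₁.IsDense x) (q : A₁.IsDense y)
             (r : A₁.IsDense (x A₁.∨ y)) →
             proj₁ (k (x A₁.∨ y , r)) ≡ proj₁ (k (x , p)) A₂.∨ proj₁ (k (y , q))
    pres-∧ : ∀ x y → (p : A₁.IsDense x) (q : A₁.IsDense y)
             (r : A₁.IsDense (x A₁.∧ y)) →
             proj₁ (k (x A₁.∧ y , r)) ≡ proj₁ (k (x , p)) A₂.∧ proj₁ (k (y , q))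
    pres-⊤ : (r : A₁.IsDense A₁.⊤) → proj₁ (k (A₁.⊤ , r)) ≡ A₂.⊤

record IsTMorphism {c₁ c₂} (A₁ : BRL c₁) (A₂ : BRL c₂)
                   (h : BRL.B A₁ → BRL.B A₂) (k : BRL.D A₁ → BRL.D A₂)
                   : Set (c₁ ⊔ c₂) where
  field
    h-hom : IsBAHom A₁ A₂ h
    k-hom : IsRLHom A₁ A₂ k
    φ-compat : ∀ a x → BRL.φ A₁ a x → BRL.φ A₂ (h a) (k x)

-- Since a ∗ d = a ∗ e, the Boolean element a lies below d ⇒ e; equivalently, d ⇒ e lies
-- in φ(¬a), since ¬¬a = a. The compatibility of (h , k) with φ carries this to
-- h(a) ≤ ¬¬h(a) ≤ k(d) ⇒ k(e), i.e. h(a) ∗ k(d) ≤ k(e). On a Boolean element ∗ agrees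
-- with ∧, so h(a) ∗ k(d) ≤ h(a) ∗ k(e), and the reverse inequality follows by symmetry.
module Submission where

open import Defs
open import Level using (Level)
open import Data.Product using (proj₁; proj₂; _,_)
open import Relation.Binary.PropositionalEquality
  using (_≡_; refl; sym; cong; cong₂; subst; subst₂; isEquivalence)
open import Relation.Binary.Structures using (IsPartialOrder)
open import Relation.Binary.Bundles using (Poset)
open import Function.Bundles using (Equivalence)
open import Algebra.Lattice.Bundles using (Lattice)
open import Algebra.Lattice.Properties.Lattice using (∨-∧-orderTheoreticLattice)
import Relation.Binary.Lattice as OrderTheoretic
import Relation.Binary.Reasoning.PartialOrder as ≤-Reasoning

private
  variable
    c c₁ c₂ : Level

module LatticeProperties (A : BRL c) where
  open BRL A

  lattice : Lattice c c
  lattice = record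
    { Carrier = Carrier
    ; _≈_ = _≡_
    ; _∨_ = _∨_
    ; _∧_ = _∧_
    ; isLattice = record
      { isEquivalence = isEquivalence
      ; ∨-comm = ∨-comm
      ; ∨-assoc = ∨-assoc
      ; ∨-cong = cong₂ _∨_
      ; ∧-comm = ∧-comm
      ; ∧-assoc = ∧-assoc
      ; ∧-cong = cong₂ _∧_
      ; absorptive = ∨-absorbs-∧ , ∧-absorbs-∨
      }
    }

  -- The library's natural order is x ≈ x ∧ y, the symmetric form of _≤_.
  private
    module O = OrderTheoretic.Lattice (∨-∧-orderTheoreticLattice lattice)

  ≤-isPartialOrder : IsPartialOrder _≡_ _≤_
  ≤-isPartialOrder = record
    { isPreorder = record
      { isEquivalence = isEquivalence
      ; reflexive = λ { refl → sym O.refl }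
      ; trans = λ x≤y y≤z → sym (O.trans (sym x≤y) (sym y≤z))
      }
    ; antisym = λ x≤y y≤x → O.antisym (sym x≤y) (sym y≤x)
    }

  poset : Poset c c c
  poset = record { isPartialOrder = ≤-isPartialOrder }

  open IsPartialOrder ≤-isPartialOrder public
    using () renaming (refl to ≤-refl; trans to ≤-trans; antisym to ≤-antisym)

  x∧y≤x : ∀ x y → x ∧ y ≤ x
  x∧y≤x x y = sym (O.x∧y≤x x y)

  x∧y≤y : ∀ x y → x ∧ y ≤ y
  x∧y≤y x y = sym (O.x∧y≤y x y)

  ∧-greatest : ∀ {x y z} → x ≤ y → x ≤ z → x ≤ y ∧ z
  ∧-greatest x≤y x≤z = sym (O.∧-greatest (sym x≤y) (sym x≤z))

  x≤x∨y : ∀ x y → x ≤ x ∨ y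
  x≤x∨y x y = sym (O.x≤x∨y x y)

  y≤x∨y : ∀ x y → y ≤ x ∨ y
  y≤x∨y x y = sym (O.y≤x∨y x y)

  ∨-least : ∀ {x y z} → x ≤ z → y ≤ z → x ∨ y ≤ z
  ∨-least x≤z y≤z = sym (O.∨-least (sym x≤z) (sym y≤z))

module ResiduationProperties (A : BRL c) where
  open BRL A
  open LatticeProperties A
  open ≤-Reasoning poset

  ⇒-intro : ∀ {x y z} → x ∗ y ≤ z → x ≤ y ⇒ z
  ⇒-intro {x} {y} {z} = Equivalence.to (residuated x y z)

  ⇒-elim : ∀ {x y z} → x ≤ y ⇒ z → x ∗ y ≤ z
  ⇒-elim {x} {y} {z} = Equivalence.from (residuated x y z)

  modus-ponens : ∀ y z → (y ⇒ z) ∗ y ≤ z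
  modus-ponens y z = ⇒-elim ≤-refl

  ∗-monoˡ : ∀ {x y} z → x ≤ y → x ∗ z ≤ y ∗ z
  ∗-monoˡ z x≤y = ⇒-elim (≤-trans x≤y (⇒-intro ≤-refl))

  ∗-monoʳ : ∀ {x y} z → x ≤ y → z ∗ x ≤ z ∗ y
  ∗-monoʳ {x} {y} z x≤y = subst₂ _≤_ (∗-comm x z) (∗-comm y z) (∗-monoˡ z x≤y)

  x∗y≤x : ∀ x y → x ∗ y ≤ x
  x∗y≤x x y = subst (x ∗ y ≤_) (∗-identityʳ x) (∗-monoʳ x (⊤-top y))

  x∗y≤y : ∀ x y → x ∗ y ≤ y
  x∗y≤y x y = subst (_≤ y) (∗-comm y x) (x∗y≤x y x)

  ∗-distribˡ-∨ : ∀ x y z → x ∗ (y ∨ z) ≤ x ∗ y ∨ x ∗ z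
  ∗-distribˡ-∨ x y z = subst (_≤ x ∗ y ∨ x ∗ z) (∗-comm (y ∨ z) x)
    (⇒-elim (∨-least (⇒-intro (subst (_≤ x ∗ y ∨ x ∗ z) (∗-comm x y) (x≤x∨y _ _)))
                     (⇒-intro (subst (_≤ x ∗ y ∨ x ∗ z) (∗-comm x z) (y≤x∨y _ _)))))

  x∗¬x≤⊥ : ∀ x → x ∗ ¬ x ≤ ⊥
  x∗¬x≤⊥ x = subst (_≤ ⊥) (∗-comm (¬ x) x) (modus-ponens x ⊥)

  x≤¬¬x : ∀ x → x ≤ ¬ ¬ x
  x≤¬¬x x = ⇒-intro (x∗¬x≤⊥ x)

  ⇒-antitoneˡ : ∀ {x y} z → x ≤ y → y ⇒ z ≤ x ⇒ z
  ⇒-antitoneˡ {x} {y} z x≤y = ⇒-intro (begin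
    (y ⇒ z) ∗ x  ≤⟨ ∗-monoʳ (y ⇒ z) x≤y ⟩
    (y ⇒ z) ∗ y  ≤⟨ modus-ponens y z ⟩
    z            ∎)

  ⇒-dense : ∀ x {y} → IsDense y → IsDense (x ⇒ y)
  ⇒-dense x {y} ¬y≡⊥ = ≤-antisym ¬[x⇒y]≤⊥ (⊥-bot _)
    where
    ¬[x⇒y]≤⊥ : ¬ (x ⇒ y) ≤ ⊥
    ¬[x⇒y]≤⊥ = subst (¬ (x ⇒ y) ≤_) ¬y≡⊥ (⇒-antitoneˡ ⊥ (⇒-intro (x∗y≤x y x)))

  ∗-equal⇒≤⇒ : ∀ {x y z} → x ∗ y ≡ x ∗ z → x ≤ y ⇒ z
  ∗-equal⇒≤⇒ {x} {y} {z} x∗y≡x∗z = ⇒-intro (subst (_≤ z) (sym x∗y≡x∗z) (x∗y≤y x z))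

module BooleanProperties (A : BRL c) where
  open BRL A
  open LatticeProperties A
  open ResiduationProperties A
  open ≤-Reasoning poset

  boolean-split : ∀ {b} → IsBoolean b → ∀ x → x ≤ x ∗ b ∨ x ∗ ¬ b
  boolean-split {b} (b∨¬b≡⊤ , _) x = begin
    x                  ≡⟨ ∗-identityʳ x ⟨
    x ∗ ⊤              ≡⟨ cong (x ∗_) b∨¬b≡⊤ ⟨
    x ∗ (b ∨ ¬ b)      ≤⟨ ∗-distribˡ-∨ x b (¬ b) ⟩
    x ∗ b ∨ x ∗ ¬ b    ∎

  boolean-∗≡∧ : ∀ {b} → IsBoolean b → ∀ x → b ∗ x ≡ b ∧ x
  boolean-∗≡∧ {b} b-bool x = ≤-antisym (∧-greatest (x∗y≤x b x) (x∗y≤y b x)) (begin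
    b ∧ x                                ≤⟨ boolean-split b-bool (b ∧ x) ⟩
    (b ∧ x) ∗ b ∨ (b ∧ x) ∗ ¬ b          ≤⟨ ∨-least b∧x∗b≤b∗x b∧x∗¬b≤b∗x ⟩
    b ∗ x                                ∎)
    where
    b∧x∗b≤b∗x : (b ∧ x) ∗ b ≤ b ∗ x
    b∧x∗b≤b∗x = subst ((b ∧ x) ∗ b ≤_) (∗-comm x b) (∗-monoˡ b (x∧y≤y b x))
    b∧x∗¬b≤b∗x : (b ∧ x) ∗ ¬ b ≤ b ∗ x
    b∧x∗¬b≤b∗x = ≤-trans (∗-monoˡ (¬ b) (x∧y≤x b x)) (≤-trans (x∗¬x≤⊥ b) (⊥-bot _))

  boolean-¬¬ : ∀ {b} → IsBoolean b → ¬ ¬ b ≡ b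
  boolean-¬¬ {b} b-bool = ≤-antisym (begin
    ¬ ¬ b                          ≤⟨ boolean-split b-bool (¬ ¬ b) ⟩
    ¬ ¬ b ∗ b ∨ ¬ ¬ b ∗ ¬ b        ≤⟨ ∨-least (x∗y≤y _ _) ¬¬b∗¬b≤b ⟩
    b                              ∎) (x≤¬¬x b)
    where
    ¬¬b∗¬b≤b : ¬ ¬ b ∗ ¬ b ≤ b
    ¬¬b∗¬b≤b = ≤-trans (subst (_≤ ⊥) (∗-comm (¬ b) (¬ ¬ b)) (x∗¬x≤⊥ (¬ b))) (⊥-bot _)

  ¬-boolean : ∀ {b} → IsBoolean b → IsBoolean (¬ b)
  ¬-boolean {b} b-bool@(b∨¬b≡⊤ , b∧¬b≡⊥) rewrite boolean-¬¬ b-bool =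
    subst (_≡ ⊤) (∨-comm b (¬ b)) b∨¬b≡⊤ , subst (_≡ ⊥) (∧-comm b (¬ b)) b∧¬b≡⊥

  boolean-≤⇒-∗-mono : ∀ {b x y} → IsBoolean b → b ≤ x ⇒ y → b ∗ x ≤ b ∗ y
  boolean-≤⇒-∗-mono {b} {x} {y} b-bool b≤x⇒y = begin
    b ∗ x   ≡⟨ boolean-∗≡∧ b-bool x ⟩
    b ∧ x   ≤⟨ ∧-greatest (x∧y≤x b x) (subst (_≤ y) (boolean-∗≡∧ b-bool x) (⇒-elim b≤x⇒y)) ⟩
    b ∧ y   ≡⟨ boolean-∗≡∧ b-bool y ⟨
    b ∗ y   ∎

module TMorphismProperties {A₁ : BRL c₁} {A₂ : BRL c₂}
         {h : BRL.B A₁ → BRL.B A₂} {k : BRL.D A₁ → BRL.D A₂}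
         (T : IsTMorphism A₁ A₂ h k) where
  private
    module A₁ = BRL A₁
    module A₂ = BRL A₂
  open IsTMorphism T
  open ResiduationProperties
  open BooleanProperties

  ≤⇒-preserved : ∀ (a : A₁.B) (d e : A₁.D) → proj₁ a A₁.≤ proj₁ d A₁.⇒ proj₁ e →
                 proj₁ (h a) A₂.≤ proj₁ (k d) A₂.⇒ proj₁ (k e)
  ≤⇒-preserved (a , a-bool) (d , d-dense) (e , e-dense) a≤d⇒e =
    LatticeProperties.≤-trans A₂ (x≤¬¬x A₂ (proj₁ (h (a , a-bool)))) ¬¬ha≤kd⇒ke
    where
    ¬a-bool : A₁.IsBoolean (A₁.¬ a)
    ¬a-bool = ¬-boolean A₁ a-bool
    d⇒e-dense : A₁.IsDense (d A₁.⇒ e)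
    d⇒e-dense = ⇒-dense A₁ d e-dense
    d⇒e∈φ[¬a] : A₁.φ (A₁.¬ a , ¬a-bool) (d A₁.⇒ e , d⇒e-dense)
    d⇒e∈φ[¬a] = subst (A₁._≤ d A₁.⇒ e) (sym (boolean-¬¬ A₁ a-bool)) a≤d⇒e
    ¬¬ha≤kd⇒ke : A₂.¬ A₂.¬ proj₁ (h (a , a-bool))
                   A₂.≤ proj₁ (k (d , d-dense)) A₂.⇒ proj₁ (k (e , e-dense))
    ¬¬ha≤kd⇒ke = subst₂ (λ u v → A₂.¬ u A₂.≤ v)
      (IsBAHom.pres-¬ h-hom a a-bool ¬a-bool)
      (IsRLHom.pres-⇒ k-hom d e d-dense e-dense d⇒e-dense)
      (φ-compat _ _ d⇒e∈φ[¬a])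

  ∗-equal-preserved-≤ : ∀ (a : A₁.B) (d e : A₁.D) →
                        proj₁ a A₁.∗ proj₁ d ≡ proj₁ a A₁.∗ proj₁ e →
                        proj₁ (h a) A₂.∗ proj₁ (k d) A₂.≤ proj₁ (h a) A₂.∗ proj₁ (k e)
  ∗-equal-preserved-≤ a d e a∗d≡a∗e =
    boolean-≤⇒-∗-mono A₂ (proj₂ (h a)) (≤⇒-preserved a d e (∗-equal⇒≤⇒ A₁ a∗d≡a∗e))

lemma3p8 : ∀ {c₁ c₂} (A₁ : BRL c₁) (A₂ : BRL c₂) → IsStonean A₁ → IsStonean A₂ →
    (h : BRL.B A₁ → BRL.B A₂) (k : BRL.D A₁ → BRL.D A₂) → IsTMorphism A₁ A₂ h k →
    (a : BRL.B A₁) (d e : BRL.D A₁) →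
    BRL._∗_ A₁ (proj₁ a) (proj₁ d) ≡ BRL._∗_ A₁ (proj₁ a) (proj₁ e) →
    BRL._∗_ A₂ (proj₁ (h a)) (proj₁ (k d)) ≡ BRL._∗_ A₂ (proj₁ (h a)) (proj₁ (k e))
lemma3p8 A₁ A₂ _ _ h k T a d e a∗d≡a∗e =
  LatticeProperties.≤-antisym A₂
    (∗-equal-preserved-≤ a d e a∗d≡a∗e)
    (∗-equal-preserved-≤ a e d (sym a∗d≡a∗e))
  where open TMorphismProperties T
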